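{- Let $\mathcal{C} = (E, \mathcal{A}, \pi, \mathit{ok}, \vdash, \Vdash)$ be a contract and let $X \subseteq E$ be a reachable set of events. Then there exists a configuration $C$ of $\mathcal{C}$ with $X \subseteq C$.
   Context: A contract is a 6-tuple $\mathcal{C} = (E, \mathcal{A}, \pi, \mathit{ok}, \vdash, \Vdash)$ where $E$ is a finite set of events, $\mathcal{A}$ is a finite set of participants, $\pi : E \to \mathcal{A}$, $\mathit{ok} \subseteq \mathcal{A} \times \mathcal{P}(E)$ satisfies $\mathit{ok}(A,X) \wedge X \subseteq Y \Rightarrow \mathit{ok}(A,Y)$, and $\vdash, \Vdash \subseteq \mathcal{P}(E) \times E$ are saturated: $X \circ e$ and $X \subseteq Y$ imply $Y \circ e$ for $\circ \in \{\vdash, \Vdash\}$. A set $C \subseteq E$ is a configuration of $\mathcal{C}$ iff there exist $e_0, \ldots, e_n$ with $\{e_0,\ldots,e_n\} = C$ such that for every $i \le n$, either $\{e_0,\ldots,e_{i-1}\} \vdash e_i$ or $C \Vdash e_i$. An event is reachable if it belongs to some configuration of $\mathcal{C}$; a set of events is reachable if each of its events is reachable. -}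

module Defs where

open import Data.Nat using (ℕ)
open import Data.Fin using (Fin)
open import Data.Fin.Subset using (Subset; _∈_; _⊆_; ⊥; _∪_; ⁅_⁆)
open import Data.List using (List; []; _∷_)
open import Data.Product using (_×_; Σ; ∃)
open import Data.Sum using (_⊎_)
open import Relation.Binary.PropositionalEquality using (_≡_)

-- Events E = Fin n, participants 𝒜 = Fin m (arbitrary finite sets).
-- Subsets of E are represented by Data.Fin.Subset n.
record Contract (n m : ℕ) : Set₁ where
  field
    π       : Fin n → Fin m
    ok      : Fin m → Subset n → Set
    ok-mono : ∀ {A X Y} → ok A X → X ⊆ Y → ok A Y
    _⊢_     : Subset n → Fin n → Set
    _⊩_     : Subset n → Fin n → Set
    ⊢-sat   : ∀ {X Y e} → X ⊢ e → X ⊆ Y → Y ⊢ e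
    ⊩-sat   : ∀ {X Y e} → X ⊩ e → X ⊆ Y → Y ⊩ e

setOf : ∀ {n} → List (Fin n) → Subset n
setOf []       = ⊥
setOf (e ∷ es) = ⁅ e ⁆ ∪ setOf es

module _ {n m : ℕ} (𝒞 : Contract n m) where
  open Contract 𝒞

  -- ValidFrom P C es : walking along the sequence es, where P is the set of
  -- events enumerated so far, each event e_i satisfies
  --   {e_0,…,e_{i-1}} ⊢ e_i  or  C ⊩ e_i.
  data ValidFrom (P C : Subset n) : List (Fin n) → Set where
    []  : ValidFrom P C []
    _∷_ : ∀ {e es} → (P ⊢ e ⊎ C ⊩ e) → ValidFrom (⁅ e ⁆ ∪ P) C es
        → ValidFrom P C (e ∷ es)

  IsConfiguration : Subset n → Set
  IsConfiguration C = ∃ λ (es : List (Fin n)) → (setOf es ≡ C) × ValidFrom ⊥ C es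

  Reachable : Fin n → Set
  Reachable e = ∃ λ C → IsConfiguration C × e ∈ C

  ReachableSet : Subset n → Set
  ReachableSet X = ∀ {e} → e ∈ X → Reachable e

module Submission where

-- Each event of X lies in some configuration; the point is that finitely
-- many configurations can always be merged into one.  If e₁…eₖ enumerates
-- C and f₁…fₗ enumerates D, then the concatenation e₁…eₖf₁…fₗ enumerates
-- C ∪ D: every step justified by ⊢ stays justified because ⊢ is saturated
-- and the prefix only grows, and every step justified by C ⊩ eᵢ or D ⊩ fⱼ
-- stays justified by (C ∪ D) ⊩ _ because ⊩ is saturated as well.
--
-- Walking through the finite
-- list of all events and absorbing, for each event of X, a configuration
-- containing it, yields the theorem.

open import Defs
open import Data.Nat using (ℕ)
open import Data.Fin using (Fin)
open import Data.Fin.Subset using (Subset; _⊆_; _∈_; _∪_; ⁅_⁆) renaming (⊥ to ∅)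
open import Data.Fin.Subset.Properties
  using (x∈p∪q⁻; x∈p∪q⁺; p⊆p∪q; q⊆p∪q; ⊥⊆; ⊆-refl; _∈?_; ∪-assoc; ∪-identityˡ)
open import Data.Product using (∃; _×_; _,_)
open import Data.Sum using (_⊎_; map₂)
import Data.Sum as Sum
open import Data.List using (List; []; _∷_; _++_; allFin)
open import Data.List.Relation.Unary.Any using (here; there)
import Data.List.Membership.Propositional as List
open import Data.List.Membership.Propositional.Properties using (∈-allFin)
open import Relation.Binary.PropositionalEquality using (_≡_; refl; sym; cong; trans)
open import Relation.Nullary using (yes; no; contradiction)

∪-monoʳ-⊆ : ∀ {n} (p : Subset n) {q r : Subset n} → q ⊆ r → p ∪ q ⊆ p ∪ r
∪-monoʳ-⊆ p q⊆r x∈p∪q = x∈p∪q⁺ (map₂ q⊆r (x∈p∪q⁻ p _ x∈p∪q))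

setOf-++ : ∀ {n} (xs ys : List (Fin n)) → setOf (xs ++ ys) ≡ setOf xs ∪ setOf ys
setOf-++ []       ys = sym (∪-identityˡ (setOf ys))
setOf-++ (x ∷ xs) ys =
  trans (cong (⁅ x ⁆ ∪_) (setOf-++ xs ys)) (sym (∪-assoc ⁅ x ⁆ (setOf xs) (setOf ys)))

module _ {n m : ℕ} (𝒞 : Contract n m) where
  open Contract 𝒞

  justified-mono : ∀ {P P′ C C′ e} → P ⊆ P′ → C ⊆ C′ →
                   P ⊢ e ⊎ C ⊩ e → P′ ⊢ e ⊎ C′ ⊩ e
  justified-mono P⊆P′ C⊆C′ = Sum.map (λ P⊢e → ⊢-sat P⊢e P⊆P′) (λ C⊩e → ⊩-sat C⊩e C⊆C′)

  ValidFrom-mono : ∀ {P P′ C C′ es} → P ⊆ P′ → C ⊆ C′ →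
                   ValidFrom 𝒞 P C es → ValidFrom 𝒞 P′ C′ es
  ValidFrom-mono P⊆P′ C⊆C′ [] = []
  ValidFrom-mono P⊆P′ C⊆C′ (_∷_ {e} step rest) =
    justified-mono P⊆P′ C⊆C′ step ∷ ValidFrom-mono (∪-monoʳ-⊆ ⁅ e ⁆ P⊆P′) C⊆C′ rest

  ValidFrom-++ : ∀ {P C xs ys} → ValidFrom 𝒞 P C xs → ValidFrom 𝒞 ∅ C ys →
                 ValidFrom 𝒞 P C (xs ++ ys)
  ValidFrom-++ []           vys = ValidFrom-mono ⊥⊆ ⊆-refl vys
  ValidFrom-++ (step ∷ vxs) vys = step ∷ ValidFrom-++ vxs vys

  ∅-configuration : IsConfiguration 𝒞 ∅
  ∅-configuration = [] , refl , []

  ∪-configuration : ∀ {C D} → IsConfiguration 𝒞 C → IsConfiguration 𝒞 D →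
                    IsConfiguration 𝒞 (C ∪ D)
  ∪-configuration (xs , refl , vxs) (ys , refl , vys) =
    xs ++ ys , setOf-++ xs ys ,
    ValidFrom-++ (ValidFrom-mono ⊆-refl (p⊆p∪q (setOf ys)) vxs)
                 (ValidFrom-mono ⊆-refl (q⊆p∪q (setOf xs) (setOf ys)) vys)

  absorb : (X : Subset n) (e : Fin n) → (e ∈ X → Reachable 𝒞 e) →
           ∀ {C} → IsConfiguration 𝒞 C →
           ∃ λ D → IsConfiguration 𝒞 D × C ⊆ D × (e ∈ X → e ∈ D)
  absorb X e reach {C} conf with e ∈? X
  ... | no  e∉X = C , conf , ⊆-refl , λ e∈X → contradiction e∈X e∉X
  ... | yes e∈X with reach e∈X
  ...   | Cₑ , confₑ , e∈Cₑ =
    C ∪ Cₑ , ∪-configuration conf confₑ , p⊆p∪q Cₑ , λ _ → q⊆p∪q C Cₑ e∈Cₑ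

  cover : (X : Subset n) → ReachableSet 𝒞 X → (ls : List (Fin n)) →
          ∃ λ C → IsConfiguration 𝒞 C × (∀ {e} → e List.∈ ls → e ∈ X → e ∈ C)
  cover X reach [] = ∅ , ∅-configuration , λ ()
  cover X reach (e ∷ ls) with cover X reach ls
  ... | C , conf , covers with absorb X e reach conf
  ...   | D , confD , C⊆D , e∈D = D , confD , covers′
    where
    covers′ : ∀ {x} → x List.∈ e ∷ ls → x ∈ X → x ∈ D
    covers′ (here refl) = e∈D
    covers′ (there x∈ls) x∈X = C⊆D (covers x∈ls x∈X)

lemma2 : {n m : ℕ} (𝒞 : Contract n m) (X : Subset n) →
    ReachableSet 𝒞 X →
    ∃ λ (C : Subset n) → IsConfiguration 𝒞 C × X ⊆ C
lemma2 {n} 𝒞 X reach with cover 𝒞 X reach (allFin n)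
... | C , conf , covers = C , conf , λ {e} e∈X → covers (∈-allFin e) e∈X
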